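{- There is an algorithm that, given a finite convergent, forward-closed, right-reduced string rewriting system $R$ over a finite alphabet $\Sigma$, decides whether $R$ is subterm-collapsing.
   Context: A string rewriting system $R$ over $\Sigma$ is a set of rules $l\to r$ ($l,r\in\Sigma^*$) with rewrite relation $xly\to_R xry$. $R$ is convergent if terminating and confluent; right-reduced if every right-hand side is irreducible. A redex is a string $wl$ with $l$ a left-hand side; it is innermost if no proper prefix is a redex; $R$ is forward-closed if every innermost redex reduces to its normal form in one step. A string $x$ causes a subterm-collapse iff there is a non-empty string $y$ with $xy\to_R^* x$; $R$ is subterm-collapsing iff some string causes a subterm-collapse. -}

module Defs where

open import Data.Nat using (ℕ)
open import Data.Fin using (Fin)
open import Data.List using (List; []; _++_)
open import Data.List.Relation.Unary.All using (All)
open import Data.List.Membership.Propositional using (_∈_)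
open import Data.Product using (_×_; _,_; ∃; ∃-syntax; Σ-syntax)
open import Relation.Nullary using (¬_)
open import Relation.Binary.PropositionalEquality using (_≡_; _≢_)
open import Relation.Binary.Construct.Closure.ReflexiveTransitive using (Star)
open import Induction.WellFounded using (WellFounded)

Str : ℕ → Set
Str k = List (Fin k)

Rule : ℕ → Set
Rule k = Str k × Str k

SRS : ℕ → Set
SRS k = List (Rule k)

module _ {k : ℕ} (R : SRS k) where

  Step : Str k → Str k → Set
  Step u v = ∃[ x ] ∃[ y ] ∃[ l ] ∃[ r ]
               ((l , r) ∈ R × u ≡ x ++ l ++ y × v ≡ x ++ r ++ y)

  Steps : Str k → Str k → Set
  Steps = Star Step

  Irreducible : Str k → Set
  Irreducible w = ¬ (∃[ v ] Step w v)

  Terminating : Set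
  Terminating = WellFounded (λ v u → Step u v)

  Confluent : Set
  Confluent = ∀ a b c → Steps a b → Steps a c → ∃[ d ] (Steps b d × Steps c d)

  Convergent : Set
  Convergent = Terminating × Confluent

  RightReduced : Set
  RightReduced = All (λ rule → Irreducible (Data.Product.proj₂ rule)) R

  Redex : Str k → Set
  Redex w = ∃[ u ] ∃[ l ] ∃[ r ] ((l , r) ∈ R × w ≡ u ++ l)

  InnermostRedex : Str k → Set
  InnermostRedex w = Redex w × (∀ p q → w ≡ p ++ q → q ≢ [] → ¬ Redex p)

  ForwardClosed : Set
  ForwardClosed = ∀ w → InnermostRedex w → ∃[ v ] (Step w v × Irreducible v)

  CausesSubtermCollapse : Str k → Set
  CausesSubtermCollapse x = ∃[ y ] (y ≢ [] × Steps (x ++ y) x)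

  SubtermCollapsing : Set
  SubtermCollapsing = ∃[ x ] CausesSubtermCollapse x

-- By forward closure, if w is irreducible then w a reaches its normal form in at most
-- one step, which rewrites a suffix of w a. Normal forms are therefore computed letter by letter
-- by a pushdown automaton whose stack is the current normal form; whether a move is allowed
-- depends only on the touched suffix and the last B letters below it, where B bounds the rule
-- lengths. A collapse x y →* x with y non-empty is a cycle of this automaton at the normal form
-- of x. Rotated to start at its lowest point, the cycle passes through a state of size at most B
-- above a context of which only a window of B letters matters. Reachability between such bounded
-- states over a fixed window is a finite relation; it is computed by saturation under four rules
-- (stay, one move, a run that keeps the lowest letter of the state, composition), after which
-- subterm-collapse is a finite check.

module Submission where

open import Defs
open import Level using (0ℓ)
open import Data.Nat using (ℕ; zero; suc; _≤_; _<_; z≤n; s≤s; _⊔_; _≤?_)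
open import Data.Nat.Properties
  using ( module ≤-Reasoning; ≤-trans; ≤-refl; ≤-pred; <⇒≤; <⇒≱; ≰⇒>; n≤1+n; m≤n⇒m≤1+n
        ; m≤m⊔n; m≤n⊔m)
open import Data.Nat.Induction using (<-wellFounded)
open import Data.Fin using (Fin)
import Data.Fin.Properties as Fin
open import Data.List
  using (List; []; _∷_; _++_; [_]; _∷ʳ_; length; filter; map; allFin; cartesianProduct; initLast; _∷ʳ′_)
open import Data.List.Properties
  using (++-assoc; ++-identityʳ; ++-monoid; ∷-injective; ∷ʳ-injective; length-++-≤ˡ; length-++-≤ʳ; ≡-dec)
open import Data.List.Extrema.Nat using (max; xs≤max)
open import Data.List.Relation.Unary.Any using (Any; here; there; any?)
open import Data.List.Relation.Unary.All using (All; _∷_; [])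
import Data.List.Relation.Unary.All as All
open import Data.List.Membership.Propositional using (_∈_; _∉_; find; lose)
open import Data.List.Membership.Propositional.Properties
  using (∈-allFin; ∈-map⁺; ∈-cartesianProduct⁺)
import Data.List.Membership.DecPropositional as DecMembership
open import Data.List.Relation.Binary.Infix.Heterogeneous using (Infix; MkView; toView; fromView)
open import Data.List.Relation.Binary.Infix.Heterogeneous.Properties using (infix?)
open import Data.List.Relation.Binary.Pointwise using (Pointwise-≡⇒≡; ≡⇒Pointwise-≡)
open import Data.Product using (_×_; _,_; ∃-syntax; proj₁; proj₂; uncurry)
open import Data.Product.Properties using () renaming (≡-dec to ≡-dec-×)
open import Data.Sum using (_⊎_; inj₁; inj₂)
open import Data.Empty using (⊥; ⊥-elim)
open import Induction.WellFounded using (Acc; acc)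
open import Relation.Nullary using (¬_; Dec; yes; no)
open import Relation.Nullary.Decidable using (_×-dec_; _⊎-dec_; map′; ¬?; decidable-stable)
open import Relation.Unary using (Pred; Decidable; _⊆_)
open import Relation.Binary.Definitions using (DecidableEquality)
open import Relation.Binary.PropositionalEquality
  using (_≡_; _≢_; refl; sym; trans; cong; subst; module ≡-Reasoning)
open import Relation.Binary.Construct.Closure.ReflexiveTransitive using (ε; _◅_; _◅◅_; gmap)
open import Tactic.MonoidSolver using (solve)

module _ {A : Set} where

  ++-equidivisible : (a b c d : List A) → a ++ b ≡ c ++ d →
    (∃[ e ] (a ≡ c ++ e × d ≡ e ++ b)) ⊎ (∃[ e ] (c ≡ a ++ e × b ≡ e ++ d))
  ++-equidivisible []      b c       d eq = inj₂ (c , refl , eq)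
  ++-equidivisible (x ∷ a) b []      d eq = inj₁ (x ∷ a , refl , sym eq)
  ++-equidivisible (x ∷ a) b (y ∷ c) d eq
    with refl , eq′ ← ∷-injective eq
    with ++-equidivisible a b c d eq′
  ... | inj₁ (e , a≡c++e , d≡e++b) = inj₁ (e , cong (x ∷_) a≡c++e , d≡e++b)
  ... | inj₂ (e , c≡a++e , b≡e++d) = inj₂ (e , cong (x ∷_) c≡a++e , b≡e++d)

  infix⇒split : ∀ {l s : List A} → Infix _≡_ l s → ∃[ x ] ∃[ y ] (s ≡ x ++ l ++ y)
  infix⇒split inf with MkView x l≋m y ← toView inf = x , y , cong (λ m → x ++ m ++ y) (sym (Pointwise-≡⇒≡ l≋m))

  split⇒infix : ∀ {l s : List A} x y → s ≡ x ++ l ++ y → Infix _≡_ l s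
  split⇒infix x y refl = fromView (MkView x (≡⇒Pointwise-≡ refl) y)

  short-infix-of-++-++ : ∀ (a b c x l y : List A) → length l ≤ length b → a ++ b ++ c ≡ x ++ l ++ y →
    (∃[ x′ ] ∃[ y′ ] (a ++ b ≡ x′ ++ l ++ y′)) ⊎ (∃[ x′ ] ∃[ y′ ] (b ++ c ≡ x′ ++ l ++ y′))
  short-infix-of-++-++ a b c x l y |l|≤|b| eq with ++-equidivisible a (b ++ c) x (l ++ y) eq
  ... | inj₂ (e , _ , bc≡ely) = inj₂ (e , y , bc≡ely)
  ... | inj₁ ([] , _ , ly≡bc)  = inj₂ ([] , y , sym ly≡bc)
  ... | inj₁ (e ∷ es , a≡x++e , ly≡e∷es++bc)
    with ++-equidivisible l y ((e ∷ es) ++ b) c (trans ly≡e∷es++bc (sym (++-assoc (e ∷ es) b c)))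
  ...   | inj₁ (g , l≡e∷es++b++g , _) = ⊥-elim (<⇒≱ |b|<|l| |l|≤|b|)
    where
    open ≤-Reasoning
    |b|<|l| : length b < length l
    |b|<|l| = begin-strict
      length b                      <⟨ s≤s (length-++-≤ʳ b {es}) ⟩
      length ((e ∷ es) ++ b)        ≤⟨ length-++-≤ˡ ((e ∷ es) ++ b) ⟩
      length (((e ∷ es) ++ b) ++ g) ≡⟨ cong length l≡e∷es++b++g ⟨
      length l                      ∎
  ...   | inj₂ (g , e∷es++b≡l++g , _) = inj₁ (x , g , (begin
    a ++ b                ≡⟨ cong (_++ b) a≡x++e ⟩
    (x ++ e ∷ es) ++ b    ≡⟨ ++-assoc x (e ∷ es) b ⟩
    x ++ (e ∷ es) ++ b    ≡⟨ cong (x ++_) e∷es++b≡l++g ⟩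
    x ++ l ++ g           ∎))
    where open ≡-Reasoning

  ∷ʳ-++ : ∀ xs (x : A) ys → xs ∷ʳ x ++ ys ≡ xs ++ x ∷ ys
  ∷ʳ-++ xs x ys = ++-assoc xs [ x ] ys

  length-++-∷-<ˡ : ∀ xs (x : A) ys → length xs < length (xs ++ x ∷ ys)
  length-++-∷-<ˡ []       x ys = s≤s z≤n
  length-++-∷-<ˡ (_ ∷ xs) x ys = s≤s (length-++-∷-<ˡ xs x ys)

  length-++-∷-<ʳ : ∀ xs (x : A) ys → length ys < length (xs ++ x ∷ ys)
  length-++-∷-<ʳ xs x ys = length-++-≤ʳ (x ∷ ys) {xs}

  splits? : ∀ {P : List A → List A → Set} → (∀ p m → Dec (P p m)) →
            ∀ q → Dec (∃[ p ] ∃[ m ] (q ≡ p ++ m × P p m))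
  splits? {P} P? [] = map′ (λ h → [] , [] , refl , h) from (P? [] [])
    where
    from : ∃[ p ] ∃[ m ] ([] ≡ p ++ m × P p m) → P [] []
    from ([] , [] , refl , h) = h
  splits? {P} P? (x ∷ q) = map′ to from (P? [] (x ∷ q) ⊎-dec splits? (λ p → P? (x ∷ p)) q)
    where
    to : P [] (x ∷ q) ⊎ ∃[ p ] ∃[ m ] (q ≡ p ++ m × P (x ∷ p) m) → ∃[ p ] ∃[ m ] (x ∷ q ≡ p ++ m × P p m)
    to (inj₁ h)                 = [] , x ∷ q , refl , h
    to (inj₂ (p , m , refl , h)) = x ∷ p , m , refl , h
    from : ∃[ p ] ∃[ m ] (x ∷ q ≡ p ++ m × P p m) → P [] (x ∷ q) ⊎ ∃[ p ] ∃[ m ] (q ≡ p ++ m × P (x ∷ p) m)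
    from ([]    , _ , refl , h) = inj₁ h
    from (_ ∷ p , m , eq   , h) with refl , q≡p++m ← ∷-injective eq = inj₂ (p , m , q≡p++m , h)

  takeLast : ℕ → List A → List A
  takeLast n []       = []
  takeLast n (x ∷ xs) with length (x ∷ xs) ≤? n
  ... | yes _ = x ∷ xs
  ... | no  _ = takeLast n xs

  length-takeLast≤ : ∀ n xs → length (takeLast n xs) ≤ n
  length-takeLast≤ n []       = z≤n
  length-takeLast≤ n (x ∷ xs) with length (x ∷ xs) ≤? n
  ... | yes |x∷xs|≤n = |x∷xs|≤n
  ... | no  _        = length-takeLast≤ n xs

  takeLast-short : ∀ n xs → length xs ≤ n → takeLast n xs ≡ xs
  takeLast-short n []       _ = refl
  takeLast-short n (x ∷ xs) |x∷xs|≤n with length (x ∷ xs) ≤? n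
  ... | yes _        = refl
  ... | no  |x∷xs|≰n = ⊥-elim (|x∷xs|≰n |x∷xs|≤n)

  takeLast-++ : ∀ n xs ys → n ≤ length ys → takeLast n (xs ++ ys) ≡ takeLast n ys
  takeLast-++ n []       ys n≤|ys| = refl
  takeLast-++ n (x ∷ xs) ys n≤|ys| with length (x ∷ xs ++ ys) ≤? n
  ... | yes ≤n = ⊥-elim (<⇒≱ (s≤s (≤-trans n≤|ys| (length-++-≤ʳ ys {xs}))) ≤n)
  ... | no  _  = takeLast-++ n xs ys n≤|ys|

  takeLast-split : ∀ n xs → ∃[ ys ] (xs ≡ ys ++ takeLast n xs × (ys ≡ [] ⊎ n ≤ length (takeLast n xs)))
  takeLast-split n []       = [] , refl , inj₁ refl
  takeLast-split n (x ∷ xs) with length (x ∷ xs) ≤? n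
  ... | yes _        = [] , refl , inj₁ refl
  ... | no  |x∷xs|≰n with takeLast-split n xs
  ...   | ys , xs≡ys++t , inj₂ n≤|t|  = x ∷ ys , cong (x ∷_) xs≡ys++t , inj₂ n≤|t|
  ...   | [] , xs≡t     , inj₁ refl   =
    [ x ] , cong (x ∷_) xs≡t , inj₂ (subst (λ t → n ≤ length t) xs≡t (≤-pred (≰⇒> |x∷xs|≰n)))

  takeLast-∷ʳ : ∀ n xs y → takeLast n (xs ∷ʳ y) ≡ takeLast n (takeLast n xs ∷ʳ y)
  takeLast-∷ʳ n xs y with takeLast-split n xs
  ... | ys , xs≡ys++t , inj₁ refl = cong (λ zs → takeLast n (zs ∷ʳ y)) xs≡ys++t
  ... | ys , xs≡ys++t , inj₂ n≤|t| = begin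
    takeLast n (xs ∷ʳ y)        ≡⟨ cong (λ zs → takeLast n (zs ∷ʳ y)) xs≡ys++t ⟩
    takeLast n ((ys ++ t) ∷ʳ y) ≡⟨ cong (takeLast n) (++-assoc ys t [ y ]) ⟩
    takeLast n (ys ++ t ∷ʳ y)   ≡⟨ takeLast-++ n ys (t ∷ʳ y) (≤-trans n≤|t| (length-++-≤ˡ t)) ⟩
    takeLast n (t ∷ʳ y)         ∎
    where
    open ≡-Reasoning
    t = takeLast n xs

  module _ {P Q : Pred A 0ℓ} (P? : Decidable P) (Q? : Decidable Q) (P⊆Q : P ⊆ Q) where

    length-filter-mono : ∀ xs → length (filter P? xs) ≤ length (filter Q? xs)
    length-filter-mono []       = z≤n
    length-filter-mono (x ∷ xs) with P? x | Q? x
    ... | yes _  | yes _ = s≤s (length-filter-mono xs)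
    ... | yes px | no ¬qx = ⊥-elim (¬qx (P⊆Q px))
    ... | no _   | yes _ = m≤n⇒m≤1+n (length-filter-mono xs)
    ... | no _   | no _  = length-filter-mono xs

    length-filter-mono-< : ∀ {xs} → Any (λ x → Q x × ¬ P x) xs → length (filter P? xs) < length (filter Q? xs)
    length-filter-mono-< {x ∷ xs} (here (qx , ¬px)) with P? x | Q? x
    ... | yes px | _      = ⊥-elim (¬px px)
    ... | no _   | yes _  = s≤s (length-filter-mono xs)
    ... | no _   | no ¬qx = ⊥-elim (¬qx qx)
    length-filter-mono-< {x ∷ xs} (there any) with P? x | Q? x
    ... | yes _  | yes _ = s≤s (length-filter-mono-< any)
    ... | yes px | no ¬qx = ⊥-elim (¬qx (P⊆Q px))
    ... | no _   | yes _ = m≤n⇒m≤1+n (length-filter-mono-< any)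
    ... | no _   | no _  = length-filter-mono-< any

strings≤ : ∀ k → ℕ → List (List (Fin k))
strings≤ k zero    = [] ∷ []
strings≤ k (suc n) = [] ∷ map (uncurry _∷_) (cartesianProduct (allFin k) (strings≤ k n))

∈-strings≤ : ∀ {k} n (s : List (Fin k)) → length s ≤ n → s ∈ strings≤ k n
∈-strings≤ zero    []      _         = here refl
∈-strings≤ (suc n) []      _         = here refl
∈-strings≤ (suc n) (x ∷ s) (s≤s |s|≤n) =
  there (∈-map⁺ (uncurry _∷_) (∈-cartesianProduct⁺ (∈-allFin x) (∈-strings≤ n s |s|≤n)))

-- Saturation of a finite set of facts

module Saturation {A : Set} (_≟_ : DecidableEquality A) (universe : List A)
  (Derivable : List A → A → Set) (derivable? : ∀ S x → Dec (Derivable S x))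
  (Valid : A → Set) (derivable⇒valid : ∀ {S x} → All Valid S → Derivable S x → Valid x) where

  open DecMembership _≟_ using (_∈?_; _∉?_)

  record Saturated : Set where
    field
      facts        : List A
      facts-valid  : All Valid facts
      facts-closed : ∀ {x} → x ∈ universe → Derivable facts x → x ∈ facts

  private
    unknown : List A → ℕ
    unknown S = length (filter (_∉? S) universe)

    unknown-∷-< : ∀ {x S} → x ∈ universe → x ∉ S → unknown (x ∷ S) < unknown S
    unknown-∷-< x∈U x∉S = length-filter-mono-< (_∉? _) (_∉? _) (λ y∉x∷S y∈S → y∉x∷S (there y∈S))
                            (lose x∈U (x∉S , λ x∉x∷S → x∉x∷S (here refl)))

    saturate : ∀ S → Acc _<_ (unknown S) → All Valid S → Saturated
    saturate S (acc smaller) valid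
      with any? (λ x → (x ∉? S) ×-dec derivable? S x) universe
    ... | yes new with x , x∈U , x∉S , derivable ← find new =
      saturate (x ∷ S) (smaller (unknown-∷-< x∈U x∉S)) (derivable⇒valid valid derivable ∷ valid)
    ... | no nothing-new = record { facts = S ; facts-valid = valid ; facts-closed = closed }
      where
      closed : ∀ {x} → x ∈ universe → Derivable S x → x ∈ S
      closed {x} x∈U derivable =
        decidable-stable (x ∈? S) (λ x∉S → nothing-new (lose x∈U (x∉S , derivable)))

  saturated : Saturated
  saturated = saturate [] (<-wellFounded _) []

module Rewriting {k : ℕ} (R : SRS k) where

  Str-≟ : (x y : Str k) → Dec (x ≡ y)
  Str-≟ = ≡-dec Fin._≟_

  step-cong : ∀ x y {u v} → Step R u v → Step R (x ++ u ++ y) (x ++ v ++ y)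
  step-cong x y (x′ , y′ , l , r , l→r∈R , refl , refl) =
    x ++ x′ , y′ ++ y , l , r , l→r∈R , solve (++-monoid (Fin k)) , solve (++-monoid (Fin k))

  steps-cong : ∀ x y {u v} → Steps R u v → Steps R (x ++ u ++ y) (x ++ v ++ y)
  steps-cong x y = gmap (λ u → x ++ u ++ y) (step-cong x y)

  lhs-infix⇒reducible : ∀ {z l r} x y → (l , r) ∈ R → z ≡ x ++ l ++ y → ¬ Irreducible R z
  lhs-infix⇒reducible {r = r} x y l→r∈R z≡xly irr =
    irr (x ++ r ++ y , x , y , _ , r , l→r∈R , z≡xly , refl)

  irreducible-infix : ∀ x y {u} → Irreducible R (x ++ u ++ y) → Irreducible R u
  irreducible-infix x y irr (v , u→v) = irr (x ++ v ++ y , step-cong x y u→v)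

  ≡⇒steps : ∀ {u v} → u ≡ v → Steps R u v
  ≡⇒steps refl = ε

  irreducible⇒steps-≡ : ∀ {u v} → Irreducible R u → Steps R u v → u ≡ v
  irreducible⇒steps-≡ irr ε           = refl
  irreducible⇒steps-≡ irr (u→w ◅ _) = ⊥-elim (irr (_ , u→w))

  normal-form-unique : Confluent R → ∀ {a b c} → Steps R a b → Steps R a c →
                       Irreducible R b → Irreducible R c → b ≡ c
  normal-form-unique confluent a→*b a→*c irr-b irr-c
    with d , b→*d , c→*d ← confluent _ _ _ a→*b a→*c =
    trans (irreducible⇒steps-≡ irr-b b→*d) (sym (irreducible⇒steps-≡ irr-c c→*d))

  reducible? : ∀ s → Dec (∃[ v ] Step R s v)
  reducible? s = map′ to from (any? (λ rule → infix? Fin._≟_ (proj₁ rule) s) R)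
    where
    to : Any (λ rule → Infix _≡_ (proj₁ rule) s) R → ∃[ v ] Step R s v
    to lhs-infix
      with (l , r) , l→r∈R , l⊑s ← find lhs-infix
      with x , y , s≡xly ← infix⇒split l⊑s =
      x ++ r ++ y , x , y , l , r , l→r∈R , s≡xly , refl
    from : ∃[ v ] Step R s v → Any (λ rule → Infix _≡_ (proj₁ rule) s) R
    from (_ , x , y , l , r , l→r∈R , s≡xly , _) = lose l→r∈R (split⇒infix x y s≡xly)

  irreducible? : ∀ s → Dec (Irreducible R s)
  irreducible? s = ¬? (reducible? s)

  irreducible-prefix : ∀ y {u} → Irreducible R (u ++ y) → Irreducible R u
  irreducible-prefix y = irreducible-infix [] y

  irreducible-suffix : ∀ x {u} → Irreducible R (x ++ u) → Irreducible R u
  irreducible-suffix x {u} irr =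
    irreducible-infix x [] (subst (λ w → Irreducible R (x ++ w)) (sym (++-identityʳ u)) irr)

  irreducible-∷ʳ-++ : ∀ c b u → Irreducible R (c ++ b ∷ u) → Irreducible R (c ∷ʳ b ++ u)
  irreducible-∷ʳ-++ c b u = subst (Irreducible R) (sym (∷ʳ-++ c b u))

  -- Every side of every rule is shorter than B. B is both the width of the context window that
  -- decides irreducibility and the size bound on shallow states.
  B : ℕ
  B = suc (max 0 (map (λ rule → length (proj₁ rule) ⊔ length (proj₂ rule)) R))

  rule-length< : ∀ {l r} → (l , r) ∈ R → length l ⊔ length r < B
  rule-length< l→r∈R = s≤s (All.lookup (xs≤max 0 _) (∈-map⁺ _ l→r∈R))

  lhs-length≤ : ∀ {l r} → (l , r) ∈ R → length l ≤ B
  lhs-length≤ l→r∈R = ≤-trans (m≤m⊔n _ _) (<⇒≤ (rule-length< l→r∈R))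

  rhs-length≤ : ∀ {l r} → (l , r) ∈ R → length r ≤ B
  rhs-length≤ l→r∈R = ≤-trans (m≤n⊔m _ _) (<⇒≤ (rule-length< l→r∈R))

  window : Str k → Str k
  window = takeLast B

  irreducible-window⁺ : ∀ c X → Irreducible R (c ++ X) → Irreducible R (window c ++ X)
  irreducible-window⁺ c X irr with c₀ , c≡c₀w , _ ← takeLast-split B c =
    irreducible-suffix c₀ (subst (Irreducible R) (trans (cong (_++ X) c≡c₀w) (++-assoc c₀ _ X)) irr)

  irreducible-window⁻ : ∀ c X → Irreducible R c → Irreducible R (window c ++ X) → Irreducible R (c ++ X)
  irreducible-window⁻ c X irr-c irr-wX (_ , x , y , l , r , l→r∈R , cX≡xly , _)
    with takeLast-split B c
  ... | [] , c≡w , inj₁ refl =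
    lhs-infix⇒reducible x y l→r∈R (trans (cong (_++ X) (sym c≡w)) cX≡xly) irr-wX
  ... | c₀ , c≡c₀w , inj₂ B≤|w|
    with short-infix-of-++-++ c₀ (window c) X x l y (≤-trans (lhs-length≤ l→r∈R) B≤|w|)
           (trans (sym (++-assoc c₀ _ X)) (trans (cong (_++ X) (sym c≡c₀w)) cX≡xly))
  ...   | inj₁ (x′ , y′ , c₀w≡) = lhs-infix⇒reducible x′ y′ l→r∈R (trans c≡c₀w c₀w≡) irr-c
  ...   | inj₂ (x′ , y′ , wX≡)  = lhs-infix⇒reducible x′ y′ l→r∈R wX≡ irr-wX

  -- The normal-form automaton

  -- The normal form c ++ q becomes c ++ v on reading a, by at most one rewrite step, which leaves
  -- the context c untouched; forward closure makes such a step exist (transition-exists).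
  data Transition (c q : Str k) (a : Fin k) : Str k → Set where
    push   : Irreducible R (c ++ q ∷ʳ a) → Transition c q a (q ∷ʳ a)
    reduce : ∀ p m r → q ≡ p ++ m → (m ∷ʳ a , r) ∈ R → Irreducible R (c ++ p ++ r) →
             Transition c q a (p ++ r)

  infixr 5 _∷_
  data Run (c : Str k) : Str k → Str k → Str k → Set where
    done : ∀ {q} → Run c q [] q
    _∷_  : ∀ {q a q₁ y v} → Transition c q a q₁ → Run c q₁ y v → Run c q (a ∷ y) v

  transition-irreducible : ∀ {c q a v} → Transition c q a v → Irreducible R (c ++ v)
  transition-irreducible (push irr)             = irr
  transition-irreducible (reduce _ _ _ _ _ irr) = irr

  run-irreducible : ∀ {c q y v} → Irreducible R (c ++ q) → Run c q y v → Irreducible R (c ++ v)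
  run-irreducible irr done      = irr
  run-irreducible _   (t ∷ run) = run-irreducible (transition-irreducible t) run

  transition-steps : ∀ {c q a v} y → Transition c q a v → Steps R (c ++ q ++ a ∷ y) (c ++ v ++ y)
  transition-steps {c} {q} {a} y (push _) = ≡⇒steps (cong (c ++_) (sym (++-assoc q [ a ] y)))
  transition-steps {c} {a = a} y (reduce p m r refl m∷ʳa→r∈R _) =
    (c ++ p , y , m ∷ʳ a , r , m∷ʳa→r∈R , before , after) ◅ ε
    where
    before : c ++ (p ++ m) ++ a ∷ y ≡ (c ++ p) ++ (m ++ [ a ]) ++ y
    before = solve (++-monoid (Fin k))
    after : c ++ (p ++ r) ++ y ≡ (c ++ p) ++ r ++ y
    after = solve (++-monoid (Fin k))

  run-steps : ∀ {c q y v} → Run c q y v → Steps R (c ++ q ++ y) (c ++ v)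
  run-steps {c} {q} done = ≡⇒steps (cong (c ++_) (++-identityʳ q))
  run-steps {y = _ ∷ y} (t ∷ run) = transition-steps y t ◅◅ run-steps run

  run-++ : ∀ {c q y u y′ v} → Run c q y u → Run c u y′ v → Run c q (y ++ y′) v
  run-++ done      run′ = run′
  run-++ (t ∷ run) run′ = t ∷ run-++ run run′

  step-∷ʳ : ∀ {z a v} → Irreducible R z → Step R (z ∷ʳ a) v →
            ∃[ x ] ∃[ l ] ∃[ r ] ((l , r) ∈ R × z ∷ʳ a ≡ x ++ l × v ≡ x ++ r)
  step-∷ʳ {z} {a} irr (x , y , l , r , rule , za≡xly , v≡xry) with initLast y
  ... | [] =
    x , l , r , rule , trans za≡xly (cong (x ++_) (++-identityʳ l)) , trans v≡xry (cong (x ++_) (++-identityʳ r))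
  ... | y′ ∷ʳ′ b = ⊥-elim (lhs-infix⇒reducible x y′ rule z≡xly′ irr)
    where
    z≡xly′ : z ≡ x ++ l ++ y′
    z≡xly′ = proj₁ (∷ʳ-injective z (x ++ l ++ y′) (trans za≡xly (solve (++-monoid (Fin k)))))

  step-∷ʳ⇒innermost : ∀ {z a v} → Irreducible R z → Step R (z ∷ʳ a) v → InnermostRedex R (z ∷ʳ a)
  step-∷ʳ⇒innermost {z} {a} irr step with x , l , r , rule , za≡xl , _ ← step-∷ʳ irr step =
    (x , l , r , rule , za≡xl) , no-proper-prefix
    where
    no-proper-prefix : ∀ p q → z ∷ʳ a ≡ p ++ q → q ≢ [] → ¬ Redex R p
    no-proper-prefix p q za≡pq q≢[] (u , l′ , r′ , rule′ , p≡ul′) with initLast q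
    ... | [] = q≢[] refl
    ... | q′ ∷ʳ′ b = lhs-infix⇒reducible u q′ rule′ z≡ul′q′ irr
      where
      z≡ul′q′ : z ≡ u ++ l′ ++ q′
      z≡ul′q′ = begin
        z              ≡⟨ proj₁ (∷ʳ-injective z (p ++ q′) (trans za≡pq (sym (++-assoc p q′ [ b ])))) ⟩
        p ++ q′        ≡⟨ cong (_++ q′) p≡ul′ ⟩
        (u ++ l′) ++ q′ ≡⟨ ++-assoc u l′ q′ ⟩
        u ++ l′ ++ q′  ∎
        where open ≡-Reasoning

  transition-window⁺ : ∀ {c q a v} → Transition c q a v → Transition (window c) q a v
  transition-window⁺ {c} {q} {a} (push irr) = push (irreducible-window⁺ c (q ∷ʳ a) irr)
  transition-window⁺ {c} (reduce p m r q≡pm rule irr) =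
    reduce p m r q≡pm rule (irreducible-window⁺ c (p ++ r) irr)

  transition-window⁻ : ∀ {c q a v} → Irreducible R c → Transition (window c) q a v → Transition c q a v
  transition-window⁻ {c} {q} {a} irr-c (push irr) = push (irreducible-window⁻ c (q ∷ʳ a) irr-c irr)
  transition-window⁻ {c} irr-c (reduce p m r q≡pm rule irr) =
    reduce p m r q≡pm rule (irreducible-window⁻ c (p ++ r) irr-c irr)

  transition? : ∀ c q a v → Dec (Transition c q a v)
  transition? c q a v = map′ to from
    ((Str-≟ v (q ∷ʳ a) ×-dec irreducible? (c ++ q ∷ʳ a))
      ⊎-dec splits? (λ p m → any? (reduces? p m) R) q)
    where
    Reduces : Str k → Str k → Rule k → Set
    Reduces p m (l , r) = l ≡ m ∷ʳ a × v ≡ p ++ r × Irreducible R (c ++ p ++ r)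
    reduces? : ∀ p m rule → Dec (Reduces p m rule)
    reduces? p m (l , r) = Str-≟ l (m ∷ʳ a) ×-dec Str-≟ v (p ++ r) ×-dec irreducible? (c ++ p ++ r)
    Spec : Set
    Spec = (v ≡ q ∷ʳ a × Irreducible R (c ++ q ∷ʳ a))
         ⊎ ∃[ p ] ∃[ m ] (q ≡ p ++ m × Any (Reduces p m) R)
    to : Spec → Transition c q a v
    to (inj₁ (refl , irr)) = push irr
    to (inj₂ (p , m , q≡pm , reduces)) with (_ , r) , rule , refl , refl , irr ← find reduces =
      reduce p m r q≡pm rule irr
    from : Transition c q a v → Spec
    from (push irr)                   = inj₁ (refl , irr)
    from (reduce p m r q≡pm rule irr) = inj₂ (p , m , q≡pm , lose rule (refl , refl , irr))

  transition-lift : ∀ {c b q a v} → Transition (c ∷ʳ b) q a v → Transition c (b ∷ q) a (b ∷ v)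
  transition-lift {c} {b} {q} {a} (push irr) = push (subst (Irreducible R) (∷ʳ-++ c b (q ∷ʳ a)) irr)
  transition-lift {c} {b} (reduce p m r refl m∷ʳa→r∈R irr) =
    reduce (b ∷ p) m r refl m∷ʳa→r∈R (subst (Irreducible R) (∷ʳ-++ c b (p ++ r)) irr)

  run-lift : ∀ {c b q y v} → Run (c ∷ʳ b) q y v → Run c (b ∷ q) y (b ∷ v)
  run-lift done      = done
  run-lift (t ∷ run) = transition-lift t ∷ run-lift run

  Short : Str k → Set
  Short s = length s ≤ B

  Shallow : Str k → Str k → Set
  Shallow q v = Short q × Short v

  data TransitionShape (c : Str k) (a : Fin k) : Str k → Str k → Set where
    lifted  : ∀ b {q v} → Transition (c ∷ʳ b) q a v → TransitionShape c a (b ∷ q) (b ∷ v)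
    shallow : ∀ {q v} → Shallow q v → TransitionShape c a q v

  transition-shape : ∀ {c q a v} → Transition c q a v → TransitionShape c a q v
  transition-shape {q = []} (push _) = shallow (z≤n , s≤s z≤n)
  transition-shape {c} {b ∷ q} {a} (push irr) = lifted b (push (irreducible-∷ʳ-++ c b (q ∷ʳ a) irr))
  transition-shape (reduce [] m r refl m∷ʳa→r∈R _) =
    shallow (≤-trans (length-++-≤ˡ m) (lhs-length≤ m∷ʳa→r∈R) , rhs-length≤ m∷ʳa→r∈R)
  transition-shape {c} (reduce (b ∷ p) m r refl m∷ʳa→r∈R irr) =
    lifted b (reduce p m r refl m∷ʳa→r∈R (irreducible-∷ʳ-++ c b (p ++ r) irr))

  data RunShape (c : Str k) : Str k → Str k → Str k → Set where
    lifted      : ∀ b {q y v} → Run (c ∷ʳ b) q y v → RunShape c (b ∷ q) y (b ∷ v)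
    via-shallow : ∀ {q y v y₁ a y₂ q₁ q₂} → y ≡ y₁ ++ a ∷ y₂ →
                  Run c q y₁ q₁ → Transition c q₁ a q₂ → Shallow q₁ q₂ → Run c q₂ y₂ v → RunShape c q y v

  run-shape : ∀ {c q a y v} → Run c q (a ∷ y) v → RunShape c q (a ∷ y) v
  run-shape (t ∷ run) with transition-shape t
  ... | shallow s = via-shallow refl done t s run
  ... | lifted b t′ with run
  ...   | done = lifted b (t′ ∷ done)
  ...   | run@(_ ∷ _) with run-shape run
  ...     | lifted _ run′                  = lifted b (t′ ∷ run′)
  ...     | via-shallow y≡ run₁ t₁ s run₂ = via-shallow (cong (_ ∷_) y≡) (t ∷ run₁) t₁ s run₂

  data ShallowCycle : Set where
    cycle : ∀ {c v y q a} → Irreducible R (c ++ v) → Shallow q v →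
            Run c v y q → Transition c q a v → ShallowCycle

  -- Rotate the cycle so that it ends with its first shallow transition.
  shallow-cycle : ∀ {c q a y} → Run c q (a ∷ y) q → ShallowCycle
  shallow-cycle run with run-shape run
  ... | lifted _ run′               = shallow-cycle run′
  ... | via-shallow _ run₁ t s run₂ = cycle (transition-irreducible t) s (run-++ run₂ run₁) t

  -- Reachability facts

  Fact : Set
  Fact = Str k × Str k × Str k

  Fact-≟ : DecidableEquality Fact
  Fact-≟ = ≡-dec-× Str-≟ (≡-dec-× Str-≟ Str-≟)

  open DecMembership Fact-≟ using (_∈?_)

  Valid : Fact → Set
  Valid (w , q , v) = ∀ c → window c ≡ w → Irreducible R (c ++ q) → ∃[ y ] Run c q y v

  LiftedFact : List Fact → Fact → Set
  LiftedFact S (w , b ∷ q , b′ ∷ v) = b ≡ b′ × (window (w ∷ʳ b) , q , v) ∈ S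
  LiftedFact S _                   = ⊥

  lifted-fact? : ∀ S F → Dec (LiftedFact S F)
  lifted-fact? S (w , []    , _)      = no λ ()
  lifted-fact? S (w , _ ∷ _ , [])     = no λ ()
  lifted-fact? S (w , b ∷ q , b′ ∷ v) = b Fin.≟ b′ ×-dec (window (w ∷ʳ b) , q , v) ∈? S

  Derivable : List Fact → Fact → Set
  Derivable S (w , q , v) =
      q ≡ v
    ⊎ Any (λ a → Transition w q a v) (allFin k)
    ⊎ LiftedFact S (w , q , v)
    ⊎ Any (λ u → (w , q , u) ∈ S × (w , u , v) ∈ S) (strings≤ k B)

  derivable? : ∀ S F → Dec (Derivable S F)
  derivable? S (w , q , v) =
        Str-≟ q v
    ⊎-dec any? (λ a → transition? w q a v) (allFin k)
    ⊎-dec lifted-fact? S (w , q , v)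
    ⊎-dec any? (λ u → (w , q , u) ∈? S ×-dec (w , u , v) ∈? S) (strings≤ k B)

  derivable⇒valid : ∀ {S F} → All Valid S → Derivable S F → Valid F
  derivable⇒valid _ (inj₁ refl) c _ _ = [] , done
  derivable⇒valid _ (inj₂ (inj₁ transition)) c refl irr with a , _ , t ← find transition =
    [ a ] , transition-window⁻ (irreducible-prefix _ irr) t ∷ done
  derivable⇒valid {F = _ , b ∷ q , _ ∷ _} valid (inj₂ (inj₂ (inj₁ (refl , fact)))) c refl irr
    with y , run ← All.lookup valid fact (c ∷ʳ b) (takeLast-∷ʳ B c b) (irreducible-∷ʳ-++ c b q irr) =
    y , run-lift run
  derivable⇒valid valid (inj₂ (inj₂ (inj₂ composable))) c w≡ irr
    with _ , _ , fact₁ , fact₂ ← find composable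
    with y₁ , run₁ ← All.lookup valid fact₁ c w≡ irr
    with y₂ , run₂ ← All.lookup valid fact₂ c w≡ (run-irreducible irr run₁) =
    y₁ ++ y₂ , run-++ run₁ run₂

  universe : List Fact
  universe = cartesianProduct (strings≤ k B) (cartesianProduct (strings≤ k B) (strings≤ k B))

  open Saturation Fact-≟ universe Derivable derivable? Valid derivable⇒valid
  open Saturated saturated

  derivable⇒fact : ∀ {w q v} → Short w → Short q → Short v → Derivable facts (w , q , v) → (w , q , v) ∈ facts
  derivable⇒fact {w} {q} {v} |w| |q| |v| = facts-closed
    (∈-cartesianProduct⁺ (∈-strings≤ B w |w|) (∈-cartesianProduct⁺ (∈-strings≤ B q |q|) (∈-strings≤ B v |v|)))

  fact-trans : ∀ {w q u v} → Short w → Short q → Short u → Short v →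
               (w , q , u) ∈ facts → (w , u , v) ∈ facts → (w , q , v) ∈ facts
  fact-trans {u = u} |w| |q| |u| |v| q⇝u u⇝v =
    derivable⇒fact |w| |q| |v| (inj₂ (inj₂ (inj₂ (lose (∈-strings≤ B u |u|) (q⇝u , u⇝v)))))

  -- Induction on (length y , q) lexicographically: a lifted run keeps its word and loses the first
  -- letter of its state, a run via a shallow transition splits into two shorter words.
  run⇒fact : ∀ n {c q y v} → length y < n → Short q → Short v → Run c q y v → (window c , q , v) ∈ facts
  shape⇒fact : ∀ n {c q y v} → length y < n → Short q → Short v → RunShape c q y v → (window c , q , v) ∈ facts

  run⇒fact (suc n) {c} _ |q| _ done = derivable⇒fact (length-takeLast≤ B c) |q| |q| (inj₁ refl)
  run⇒fact (suc n) |y|<n |q| |v| run@(_ ∷ _) = shape⇒fact (suc n) |y|<n |q| |v| (run-shape run)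

  shape⇒fact n {c} |y|<n |b∷q′| |b∷v′| (lifted b {q′} {_} {v′} run′) =
    derivable⇒fact (length-takeLast≤ B c) |b∷q′| |b∷v′| (inj₂ (inj₂ (inj₁ (refl , q′⇝v′))))
    where
    q′⇝v′ : (window (window c ∷ʳ b) , q′ , v′) ∈ facts
    q′⇝v′ = subst (λ w → (w , q′ , v′) ∈ facts) (takeLast-∷ʳ B c b)
      (run⇒fact n |y|<n (≤-trans (n≤1+n _) |b∷q′|) (≤-trans (n≤1+n _) |b∷v′|) run′)
  shape⇒fact (suc n) {c} {q} {v = v} |y|<n |q| |v|
             (via-shallow {y₁ = y₁} {a} {y₂} {q₁} {q₂} y≡ run₁ t (|q₁| , |q₂|) run₂) =
    fact-trans |w| |q| |q₁| |v| q⇝q₁ (fact-trans |w| |q₁| |q₂| |v| q₁⇝q₂ q₂⇝v)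
    where
    |w| : Short (window c)
    |w| = length-takeLast≤ B c
    shorter : ∀ {m} → m < length (y₁ ++ a ∷ y₂) → m < n
    shorter m< = ≤-trans m< (≤-pred (subst (λ y → length y < suc n) y≡ |y|<n))
    q⇝q₁ : (window c , q , q₁) ∈ facts
    q⇝q₁ = run⇒fact n (shorter (length-++-∷-<ˡ y₁ a y₂)) |q| |q₁| run₁
    q₁⇝q₂ : (window c , q₁ , q₂) ∈ facts
    q₁⇝q₂ = derivable⇒fact |w| |q₁| |q₂| (inj₂ (inj₁ (lose (∈-allFin a) (transition-window⁺ t))))
    q₂⇝v : (window c , q₂ , v) ∈ facts
    q₂⇝v = run⇒fact n (shorter (length-++-∷-<ʳ y₁ a y₂)) |q₂| |v| run₂

  Closing : Fact → Set
  Closing (w , v , q) = Short w × Irreducible R (w ++ q) × Any (λ a → Transition w q a v) (allFin k)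

  closing? : ∀ F → Dec (Closing F)
  closing? (w , v , q) =
    length w ≤? B ×-dec irreducible? (w ++ q) ×-dec any? (λ a → transition? w q a v) (allFin k)

  closing⇒collapsing : Any Closing facts → SubtermCollapsing R
  closing⇒collapsing closing
    with (w , v , q) , v⇝q , |w| , irr , transition ← find closing
    with a , _ , t ← find transition
    with y , run ← All.lookup facts-valid v⇝q w (takeLast-short B w |w|) (transition-irreducible t) =
    w ++ q , a ∷ y , (λ ()) ,
    subst (λ x → Steps R x (w ++ q)) (sym (++-assoc w q (a ∷ y))) (run-steps (t ∷ run))

  cycle⇒closing : ShallowCycle → Any Closing facts
  cycle⇒closing (cycle {c} {v} {q = q} irr (|q| , |v|) run t) =
    lose (run⇒fact _ ≤-refl |v| |q| run)
      ( length-takeLast≤ B c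
      , irreducible-window⁺ c q (run-irreducible irr run)
      , lose (∈-allFin _) (transition-window⁺ t))

  module _ (terminating : Terminating R) (confluent : Confluent R) (forward-closed : ForwardClosed R) where

    lhs-nonempty : ∀ {r} → ¬ (([] , r) ∈ R)
    lhs-nonempty {r} []→r∈R = grows (terminating [])
      where
      grows : ∀ {w} → Acc (λ v u → Step R u v) w → ⊥
      grows {w} (acc rs) = grows (rs ([] , w , [] , r , []→r∈R , refl , refl))

    irreducible-[] : Irreducible R []
    irreducible-[] (_ , [] , _ , [] , _ , []→r∈R , _) = lhs-nonempty []→r∈R
    irreducible-[] (_ , [] , _ , _ ∷ _ , _ , _ , () , _)
    irreducible-[] (_ , _ ∷ _ , _ , _ , _ , _ , () , _)

    transition-exists : ∀ {z} → Irreducible R z → ∀ a → ∃[ v ] Transition [] z a v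
    transition-exists {z} irr a with reducible? (z ∷ʳ a)
    ... | no irr′ = z ∷ʳ a , push irr′
    ... | yes (_ , step)
      with v , step′ , irr-v ← forward-closed (z ∷ʳ a) (step-∷ʳ⇒innermost irr step)
      with x , l , r , rule , za≡xl , v≡xr ← step-∷ʳ irr step′
      with initLast l
    ...   | [] = ⊥-elim (lhs-nonempty rule)
    ...   | m ∷ʳ′ a′
      with z≡xm , refl ← ∷ʳ-injective z (x ++ m) (trans za≡xl (sym (++-assoc x m [ a′ ]))) =
      x ++ r , reduce x m r z≡xm rule (subst (Irreducible R) v≡xr irr-v)

    run-exists : ∀ {q} → Irreducible R q → ∀ y → ∃[ v ] Run [] q y v
    run-exists irr []      = _ , done
    run-exists irr (a ∷ y)
      with q₁ , t ← transition-exists irr a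
      with v , run ← run-exists (transition-irreducible t) y =
      v , t ∷ run

    collapse⇒cycle : ∀ {x} → CausesSubtermCollapse R x → ShallowCycle
    collapse⇒cycle ([] , y≢[] , _) = ⊥-elim (y≢[] refl)
    collapse⇒cycle {x} (y@(_ ∷ _) , _ , xy→*x)
      with x̂ , x-run ← run-exists irreducible-[] x
      with irr-x̂ ← run-irreducible irreducible-[] x-run
      with _ , x̂y-run ← run-exists irr-x̂ y
      with refl ← normal-form-unique confluent
                    (xy→*x ◅◅ run-steps x-run) (steps-cong [] y (run-steps x-run) ◅◅ run-steps x̂y-run)
                    irr-x̂ (run-irreducible irr-x̂ x̂y-run) =
      shallow-cycle x̂y-run

    subterm-collapsing? : Dec (SubtermCollapsing R)
    subterm-collapsing? = map′ closing⇒collapsing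
      (λ (_ , collapse) → cycle⇒closing (collapse⇒cycle collapse)) (any? closing? facts)

corollary2 : (k : ℕ) (R : SRS k) → Convergent R → ForwardClosed R → RightReduced R →
    Dec (SubtermCollapsing R)
corollary2 k R (terminating , confluent) forward-closed _ =
  Rewriting.subterm-collapsing? R terminating confluent forward-closed
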